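{- Let $T,S\subseteq\mathbb{Z}_{>0}$ be finite and let $x\in T\setminus(T\triangleleft S)$. Then $(T\setminus\{x\})\triangleleft S=T\triangleleft S$.
   Context: For finite $T,S\subseteq\mathbb{Z}_{>0}$, $T\triangleleft S$ is computed by going through $s\in S$ from largest to smallest; each $s$ picks the largest not-yet-picked $t\in T$ with $t<s$, if one exists; $T\triangleleft S$ is the set of picked elements. -}

module Defs where

open import Data.Nat using (ℕ; _<_; _<?_; _≟_)
open import Data.Nat.Properties using (≤-decTotalOrder)
open import Data.List using (List; []; _∷_; filter; reverse)
open import Data.List.Sort using (sort)
open import Data.Maybe using (Maybe; just; nothing)
open import Relation.Nullary using (¬_; yes; no)
open import Relation.Nullary.Decidable using (¬?)

-- Finite subsets of ℤ_{>0} are represented as duplicate-free lists of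
-- positive naturals; set equality is equality of membership.

remove : ℕ → List ℕ → List ℕ
remove t = filter (λ u → ¬? (u ≟ t))

maxM : Maybe ℕ → ℕ → Maybe ℕ
maxM nothing  u = just u
maxM (just m) u with m <? u
... | yes _ = just u
... | no  _ = just m

maxBelow : ℕ → List ℕ → Maybe ℕ
maxBelow s [] = nothing
maxBelow s (u ∷ us) with u <? s
... | yes _ = maxM (maxBelow s us) u
... | no  _ = maxBelow s us

-- process the (already decreasingly ordered) elements s of S; the first
-- argument is the set of not-yet-picked elements of T
pickGo : List ℕ → List ℕ → List ℕ
pickGo R [] = []
pickGo R (s ∷ ss) with maxBelow s R
... | nothing = pickGo R ss
... | just t  = t ∷ pickGo (remove t R) ss

sortDesc : List ℕ → List ℕ
sortDesc S = reverse (sort ≤-decTotalOrder S)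

_◁_ : List ℕ → List ℕ → List ℕ
T ◁ S = pickGo T (sortDesc S)

-- Deleting from the pool a value that is never picked does not change any
-- pick: if the largest remaining t < s is not x, it is still the largest
-- after x is gone (x ≤ t or x ≥ s), and the pools on both sides keep
-- differing only by x. So the two pickings agree step by step, as lists.
module Submission where

open import Defs
open import Data.Bool using (true; false)
open import Data.Nat using (ℕ; _<_; _≤_; _<?_)
open import Data.Nat.Properties using (≤-refl; ≤-trans; ≤-antisym; <⇒≤; ≮⇒≥; ≤⇒≯)
open import Data.List using (List; []; _∷_; filter)
open import Data.List.Relation.Unary.All using (All)
open import Data.List.Relation.Unary.Any using (here; there)
open import Data.List.Relation.Unary.Unique.Propositional using (Unique)
open import Data.List.Membership.Propositional using (_∈_; _∉_)
open import Data.List.Membership.Propositional.Properties using (∈-filter⁺; ∈-filter⁻)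
open import Data.Maybe using (Maybe; just; nothing)
open import Data.Product using (proj₁)
open import Function using (_∘_)
open import Function.Bundles using (_⇔_; mk⇔)
open import Relation.Binary.PropositionalEquality
open import Relation.Nullary using (does; yes; no; contradiction)
open import Relation.Unary using (Pred; Decidable)

filter-comm : ∀ {a p q} {A : Set a} {P : Pred A p} {Q : Pred A q}
              (P? : Decidable P) (Q? : Decidable Q) →
              filter P? ∘ filter Q? ≗ filter Q? ∘ filter P?
filter-comm P? Q? [] = refl
filter-comm P? Q? (x ∷ xs) with does (P? x) in p | does (Q? x) in q
... | false | false = filter-comm P? Q? xs
... | false | true  rewrite p = filter-comm P? Q? xs
... | true  | false rewrite q = filter-comm P? Q? xs
... | true  | true  rewrite p | q = cong (x ∷_) (filter-comm P? Q? xs)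

remove-comm : ∀ a b R → remove a (remove b R) ≡ remove b (remove a R)
remove-comm a b = filter-comm _ _

∈-remove⁻ : ∀ {v x R} → v ∈ remove x R → v ∈ R
∈-remove⁻ = proj₁ ∘ ∈-filter⁻ _

∈-remove⁺ : ∀ {v x R} → v ∈ R → v ≢ x → v ∈ remove x R
∈-remove⁺ = ∈-filter⁺ _

data IsMaxBelow (s : ℕ) (R : List ℕ) : Maybe ℕ → Set where
  none : (∀ {u} → u ∈ R → s ≤ u) → IsMaxBelow s R nothing
  some : ∀ {m} → m ∈ R → m < s → (∀ {u} → u ∈ R → u < s → u ≤ m) →
         IsMaxBelow s R (just m)

isMaxBelow-∷-≥ : ∀ {s u R r} → s ≤ u → IsMaxBelow s R r → IsMaxBelow s (u ∷ R) r
isMaxBelow-∷-≥ s≤u (none above) = none λ { (here refl) → s≤u ; (there v) → above v }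
isMaxBelow-∷-≥ s≤u (some m∈ m<s below) =
  some (there m∈) m<s λ { (here refl) u<s → contradiction u<s (≤⇒≯ s≤u)
                        ; (there v) → below v }

isMaxBelow-∷-< : ∀ {s u R r} → u < s → IsMaxBelow s R r → IsMaxBelow s (u ∷ R) (maxM r u)
isMaxBelow-∷-< u<s (none above) =
  some (here refl) u<s λ { (here refl) _ → ≤-refl
                         ; (there v) v<s → contradiction v<s (≤⇒≯ (above v)) }
isMaxBelow-∷-< {u = u} u<s (some {m} m∈ m<s below) with m <? u
... | yes m<u = some (here refl) u<s λ { (here refl) _ → ≤-refl
                                       ; (there v) v<s → ≤-trans (below v v<s) (<⇒≤ m<u) }
... | no m≮u = some (there m∈) m<s λ { (here refl) _ → ≮⇒≥ m≮u
                                     ; (there v) → below v }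

maxBelow-isMaxBelow : ∀ s R → IsMaxBelow s R (maxBelow s R)
maxBelow-isMaxBelow s [] = none λ ()
maxBelow-isMaxBelow s (u ∷ R) with u <? s
... | yes u<s = isMaxBelow-∷-< u<s (maxBelow-isMaxBelow s R)
... | no u≮s = isMaxBelow-∷-≥ (≮⇒≥ u≮s) (maxBelow-isMaxBelow s R)

maxBelow-remove : ∀ s x R → maxBelow s R ≢ just x → maxBelow s (remove x R) ≡ maxBelow s R
maxBelow-remove s x R r≢x
  with maxBelow s R | maxBelow-isMaxBelow s R
     | maxBelow s (remove x R) | maxBelow-isMaxBelow s (remove x R)
... | nothing | _ | nothing | _ = refl
... | nothing | none above | just _ | some m′∈ m′<s _ =
  contradiction m′<s (≤⇒≯ (above (∈-remove⁻ m′∈)))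
... | just m | some m∈ m<s _ | nothing | none above′ =
  contradiction m<s (≤⇒≯ (above′ (∈-remove⁺ m∈ (r≢x ∘ cong just))))
... | just m | some m∈ m<s below | just m′ | some m′∈ m′<s below′ =
  cong just (≤-antisym (below (∈-remove⁻ m′∈) m′<s)
                       (below′ (∈-remove⁺ m∈ (r≢x ∘ cong just)) m<s))

pickGo-remove : ∀ x R ss → x ∉ pickGo R ss → pickGo (remove x R) ss ≡ pickGo R ss
pickGo-remove x R [] _ = refl
pickGo-remove x R (s ∷ ss) x∉ with maxBelow s R | maxBelow-remove s x R
... | nothing | same rewrite same (λ ()) = pickGo-remove x R ss x∉
... | just t  | same rewrite same (λ { refl → x∉ (here refl) }) = cong (t ∷_) (begin
  pickGo (remove t (remove x R)) ss  ≡⟨ cong (λ R′ → pickGo R′ ss) (remove-comm t x R) ⟩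
  pickGo (remove x (remove t R)) ss  ≡⟨ pickGo-remove x (remove t R) ss (x∉ ∘ there) ⟩
  pickGo (remove t R) ss             ∎)
  where open ≡-Reasoning

lemma4p3 : (T S : List ℕ) → Unique T → Unique S → All (0 <_) T → All (0 <_) S →
           (x : ℕ) → x ∈ T → x ∉ (T ◁ S) →
           ∀ y → (y ∈ (remove x T ◁ S)) ⇔ (y ∈ (T ◁ S))
lemma4p3 T S _ _ _ _ x _ x∉ y = mk⇔ (subst (y ∈_) same) (subst (y ∈_) (sym same))
  where
  same : remove x T ◁ S ≡ T ◁ S
  same = pickGo-remove x T (sortDesc S) x∉
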